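{- Let $n\ge0$, $k\ge1$ and $m\ge0$ be integers. The points $(J_{n+2ik},J_{n+(2i+1)k})$ for $i=0,1,\dots,m$ are collinear, and the points $(j_{n+2ik},j_{n+(2i+1)k})$ for $i=0,1,\dots,m$ are collinear.
   Context: $J_n=\frac13\left(2^n-(-1)^n\right)$ are the Jacobsthal numbers and $j_n=2^n+(-1)^n$ are the Jacobsthal–Lucas numbers. -}

module Defs where

open import Data.Nat using (ℕ; _≤_)
open import Data.Integer using (ℤ; +_; -_; _-_; _*_)
open import Data.Integer.DivMod using (_/_)
open import Data.Product using (_×_; _,_; proj₁; proj₂)
open import Relation.Binary.PropositionalEquality using (_≡_)

neg1^ : ℕ → ℤ
neg1^ ℕ.zero = + 1
neg1^ (ℕ.suc n) = - neg1^ n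

pow2 : ℕ → ℤ
pow2 n = + (2 Data.Nat.^ n)
  where import Data.Nat

-- Jacobsthal numbers: J n = (2^n - (-1)^n) / 3  (exact division)
J : ℕ → ℤ
J n = (pow2 n - neg1^ n) / + 3

jL : ℕ → ℤ
jL n = pow2 n Data.Integer.+ neg1^ n
  where import Data.Integer

Collinear : (ℕ → ℤ × ℤ) → ℕ → Set
Collinear P m = ∀ a b c → a ≤ m → b ≤ m → c ≤ m →
  (proj₁ (P b) - proj₁ (P a)) * (proj₂ (P c) - proj₂ (P a))
    - (proj₁ (P c) - proj₁ (P a)) * (proj₂ (P b) - proj₂ (P a)) ≡ + 0

{-# OPTIONS --safe #-}
-- Both sequences satisfy an addition law f (m + k) = 2ᵏ f m + (-1)ᵐ c with c
-- depending only on k (c = J k, resp. c = (-1)ᵏ - 2ᵏ).  Since n + 2ik has the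
-- parity of n, every point (f (n + 2ik), f (n + 2ik + k)) lies on the line
-- y = 2ᵏ x + (-1)ⁿ c.
module Submission where

open import Defs
open import Data.Nat using (ℕ; _+_; _*_; _≤_)
open import Data.Product using (_×_; _,_)
import Data.Nat as ℕ
import Data.Nat.Properties as ℕ
import Data.Nat.Divisibility as ℕ
import Data.Nat.Tactic.RingSolver as ℕ-Solver
open import Data.Integer as ℤ using (ℤ; +_; -[1+_]; -_; _-_; ∣_∣; NonZero)
open import Data.Integer.DivMod using (_/_; _%_; _%ℕ_; a≡a%n+[a/n]*n)
open import Data.Integer.Divisibility.Signed
  using (_∣_; divides; ∣-refl; ∣⇒∣ᵤ; ∣m∣n⇒∣m-n; ∣m⇒∣m*n)
import Data.Integer.Properties as ℤ
open import Data.Integer.Tactic.RingSolver using (solve-∀)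
open import Relation.Binary.PropositionalEquality hiding (J)
open ≡-Reasoning

∣i∣%d≡0⇒i%ℕd≡0 : ∀ i d .{{_ : ℕ.NonZero d}} → ∣ i ∣ ℕ.% d ≡ 0 → i %ℕ d ≡ 0
∣i∣%d≡0⇒i%ℕd≡0 (+ i)    d eq = eq
∣i∣%d≡0⇒i%ℕd≡0 -[1+ i ] d eq with ℕ.suc i ℕ.% d | eq
... | .0 | refl = refl

∣⇒%≡0 : ∀ {d i} .{{_ : NonZero d}} → d ∣ i → i % d ≡ 0
∣⇒%≡0 {d} {i} d∣i = ∣i∣%d≡0⇒i%ℕd≡0 i ∣ d ∣ (ℕ.n∣m⇒m%n≡0 ∣ i ∣ ∣ d ∣ (∣⇒∣ᵤ d∣i))

∣⇒[i/d]*d≡i : ∀ {d i} .{{_ : NonZero d}} → d ∣ i → i / d ℤ.* d ≡ i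
∣⇒[i/d]*d≡i {d} {i} d∣i = sym (begin
  i                         ≡⟨ a≡a%n+[a/n]*n i d ⟩
  + (i % d) ℤ.+ i / d ℤ.* d ≡⟨ cong (λ r → + r ℤ.+ i / d ℤ.* d) (∣⇒%≡0 d∣i) ⟩
  + 0 ℤ.+ i / d ℤ.* d       ≡⟨ ℤ.+-identityˡ _ ⟩
  i / d ℤ.* d               ∎)

pow2-+ : ∀ m n → pow2 (m + n) ≡ pow2 m ℤ.* pow2 n
pow2-+ m n = trans (cong +_ (ℕ.^-distribˡ-+-* 2 m n)) (ℤ.pos-* (2 ℕ.^ m) (2 ℕ.^ n))

neg1^-+ : ∀ m n → neg1^ (m + n) ≡ neg1^ m ℤ.* neg1^ n
neg1^-+ ℕ.zero    n = sym (ℤ.*-identityˡ (neg1^ n))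
neg1^-+ (ℕ.suc m) n = trans (cong -_ (neg1^-+ m n)) (ℤ.neg-distribˡ-* (neg1^ m) (neg1^ n))

neg1^-2* : ∀ n → neg1^ (2 * n) ≡ + 1
neg1^-2* ℕ.zero    = refl
neg1^-2* (ℕ.suc n) = begin
  neg1^ (2 * ℕ.suc n)   ≡⟨ cong neg1^ (ℕ.*-suc 2 n) ⟩
  - - neg1^ (2 * n)     ≡⟨ ℤ.neg-involutive (neg1^ (2 * n)) ⟩
  neg1^ (2 * n)         ≡⟨ neg1^-2* n ⟩
  + 1                   ∎

3∣pow2-neg1^ : ∀ n → + 3 ∣ pow2 n - neg1^ n
3∣pow2-neg1^ ℕ.zero    = divides (+ 0) refl
3∣pow2-neg1^ (ℕ.suc n) = subst (+ 3 ∣_) (sym recurrence)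
  (∣m∣n⇒∣m-n (∣m⇒∣m*n (pow2 n) ∣-refl) (3∣pow2-neg1^ n))
  where
  regroup : ∀ p s → + 2 ℤ.* p - - s ≡ + 3 ℤ.* p - (p - s)
  regroup = solve-∀
  recurrence : pow2 (ℕ.suc n) - neg1^ (ℕ.suc n) ≡ + 3 ℤ.* pow2 n - (pow2 n - neg1^ n)
  recurrence = trans (cong (_- neg1^ (ℕ.suc n)) (ℤ.pos-* 2 (2 ℕ.^ n))) (regroup (pow2 n) (neg1^ n))

J*3≡pow2-neg1^ : ∀ n → J n ℤ.* + 3 ≡ pow2 n - neg1^ n
J*3≡pow2-neg1^ n = ∣⇒[i/d]*d≡i (3∣pow2-neg1^ n)

J-+ : ∀ m n → J (m + n) ≡ pow2 n ℤ.* J m ℤ.+ neg1^ m ℤ.* J n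
J-+ m n = ℤ.*-cancelʳ-≡ (J (m + n)) (pow2 n ℤ.* J m ℤ.+ neg1^ m ℤ.* J n) (+ 3) (begin
  J (m + n) ℤ.* + 3
    ≡⟨ J*3≡pow2-neg1^ (m + n) ⟩
  pow2 (m + n) - neg1^ (m + n)
    ≡⟨ cong₂ _-_ (pow2-+ m n) (neg1^-+ m n) ⟩
  pow2 m ℤ.* pow2 n - neg1^ m ℤ.* neg1^ n
    ≡⟨ expand (pow2 m) (pow2 n) (neg1^ m) (neg1^ n) ⟩
  pow2 n ℤ.* (pow2 m - neg1^ m) ℤ.+ neg1^ m ℤ.* (pow2 n - neg1^ n)
    ≡⟨ cong₂ (λ a b → pow2 n ℤ.* a ℤ.+ neg1^ m ℤ.* b) (J*3≡pow2-neg1^ m) (J*3≡pow2-neg1^ n) ⟨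
  pow2 n ℤ.* (J m ℤ.* + 3) ℤ.+ neg1^ m ℤ.* (J n ℤ.* + 3)
    ≡⟨ factor (pow2 n) (J m) (neg1^ m) (J n) ⟩
  (pow2 n ℤ.* J m ℤ.+ neg1^ m ℤ.* J n) ℤ.* + 3
    ∎)
  where
  expand : ∀ a b s t → a ℤ.* b - s ℤ.* t ≡ b ℤ.* (a - s) ℤ.+ s ℤ.* (b - t)
  expand = solve-∀
  factor : ∀ a x s y → a ℤ.* (x ℤ.* + 3) ℤ.+ s ℤ.* (y ℤ.* + 3) ≡ (a ℤ.* x ℤ.+ s ℤ.* y) ℤ.* + 3
  factor = solve-∀

jL-+ : ∀ m n → jL (m + n) ≡ pow2 n ℤ.* jL m ℤ.+ neg1^ m ℤ.* (neg1^ n - pow2 n)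
jL-+ m n = begin
  pow2 (m + n) ℤ.+ neg1^ (m + n)                ≡⟨ cong₂ ℤ._+_ (pow2-+ m n) (neg1^-+ m n) ⟩
  pow2 m ℤ.* pow2 n ℤ.+ neg1^ m ℤ.* neg1^ n     ≡⟨ expand (pow2 m) (pow2 n) (neg1^ m) (neg1^ n) ⟩
  pow2 n ℤ.* jL m ℤ.+ neg1^ m ℤ.* (neg1^ n - pow2 n) ∎
  where
  expand : ∀ a b s t → a ℤ.* b ℤ.+ s ℤ.* t ≡ b ℤ.* (a ℤ.+ s) ℤ.+ s ℤ.* (t - b)
  expand = solve-∀

collinear-graph : ∀ (x y : ℕ → ℤ) a b → (∀ i → y i ≡ a ℤ.* x i ℤ.+ b) →
  ∀ m → Collinear (λ i → x i , y i) m
collinear-graph x y a b y≡ax+b m i j l _ _ _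
  rewrite y≡ax+b i | y≡ax+b j | y≡ax+b l = det≡0 a b (x i) (x j) (x l)
  where
  det≡0 : ∀ a b u v w → (v - u) ℤ.* ((a ℤ.* w ℤ.+ b) - (a ℤ.* u ℤ.+ b))
    - (w - u) ℤ.* ((a ℤ.* v ℤ.+ b) - (a ℤ.* u ℤ.+ b)) ≡ + 0
  det≡0 = solve-∀

module _ (f : ℕ → ℤ) (k : ℕ) (c : ℤ)
         (f-+ : ∀ m → f (m + k) ≡ pow2 k ℤ.* f m ℤ.+ neg1^ m ℤ.* c) where

  collinear-even-odd : ∀ n m → Collinear (λ i → f (n + 2 * i * k) , f (n + (2 * i + 1) * k)) m
  collinear-even-odd n = collinear-graph _ _ (pow2 k) (neg1^ n ℤ.* c) on-line
    where
    odd-index : ∀ n i k → n + (2 * i + 1) * k ≡ n + 2 * i * k + k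
    odd-index = ℕ-Solver.solve-∀
    even-sign : ∀ i → neg1^ (n + 2 * i * k) ≡ neg1^ n
    even-sign i = begin
      neg1^ (n + 2 * i * k)           ≡⟨ cong (λ e → neg1^ (n + e)) (ℕ.*-assoc 2 i k) ⟩
      neg1^ (n + 2 * (i * k))         ≡⟨ neg1^-+ n (2 * (i * k)) ⟩
      neg1^ n ℤ.* neg1^ (2 * (i * k)) ≡⟨ cong (neg1^ n ℤ.*_) (neg1^-2* (i * k)) ⟩
      neg1^ n ℤ.* + 1                 ≡⟨ ℤ.*-identityʳ (neg1^ n) ⟩
      neg1^ n                         ∎
    on-line : ∀ i → f (n + (2 * i + 1) * k) ≡ pow2 k ℤ.* f (n + 2 * i * k) ℤ.+ neg1^ n ℤ.* c
    on-line i = begin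
      f (n + (2 * i + 1) * k)
        ≡⟨ cong f (odd-index n i k) ⟩
      f (n + 2 * i * k + k)
        ≡⟨ f-+ (n + 2 * i * k) ⟩
      pow2 k ℤ.* f (n + 2 * i * k) ℤ.+ neg1^ (n + 2 * i * k) ℤ.* c
        ≡⟨ cong (λ s → pow2 k ℤ.* f (n + 2 * i * k) ℤ.+ s ℤ.* c) (even-sign i) ⟩
      pow2 k ℤ.* f (n + 2 * i * k) ℤ.+ neg1^ n ℤ.* c
        ∎

theorem2p7 : (n k m : ℕ) → 1 ≤ k →
    Collinear (λ i → J (n + 2 * i * k) , J (n + (2 * i + 1) * k)) m
    × Collinear (λ i → jL (n + 2 * i * k) , jL (n + (2 * i + 1) * k)) m
theorem2p7 n k m _ =
  collinear-even-odd J k (J k) (λ m → J-+ m k) n m ,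
  collinear-even-odd jL k (neg1^ k - pow2 k) (λ m → jL-+ m k) n m
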